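{- Let $Z\in\{H,V\}^k$ contain $h$ occurrences of $H$ and $v$ occurrences of $V$, let $B_1,B_2$ be diagonally connected $Z$-blocks, and let $T=(P,c)$ be a source $Z$-bridge with $P=(P(0),\dots,P(k))$, $P(0)=B_1^+$ and $P(k)=B_2^+$. Let $\tilde c$ be a configuration with $\tilde c(x)=c(x)$ for $x\in P$ (so $\tilde c(P(0))=4$ and $\tilde c(P(j))=3$ for $1\le j\le k$) and $\tilde c(x)\le 3$ for every cell $x\notin P$. Then $F(\tilde c,Z)(P(k))=4$.
   Context: Cells are $\mathbb{Z}^2$; $H=(1,0)$, $V=(0,1)$ (second coordinate increasing downward). Configurations are maps $c:\mathbb{Z}^2\to\{0,\dots,5\}$; updates: $F(c,H)(x)=c(x)-2[c(x)\ge4]+[c(x+H)\ge4]+[c(x-H)\ge4]$, and $F(c,V)$ likewise with $V$. For $Z=Z(1)\cdots Z(k)$: $F(c,Z,0)=c$, $F(c,Z,s)=F(F(c,Z,s-1),Z(((s-1)\bmod k)+1))$, and $F(c,Z)=F(c,Z,k)$. $Z$-blocks: the rectangles $a+(ih,jv)+\{0,\dots,h-1\}\times\{0,\dots,v-1\}$ of a fixed partition of $\mathbb{Z}^2$; $B^+$ is the upper-left cell of block $B$ and $B^-=B^++(0,v-1)$ its lower-left cell. $B_1,B_2$ are diagonally connected if $B_2^+=B_1^++(\sigma h,\tau v)$ for some $\sigma,\tau\in\{ -1,1\}$. A $Z$-path is $P=(P(0),\dots,P(l))$, $l\le k$, such that for some $\alpha,\beta\in\{ -1,1\}$ and all $1\le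 s\le l$, $P(s)=P(s-1)+\alpha H$ if $Z(s)=H$ and $P(s)=P(s-1)+\beta V$ if $Z(s)=V$. A $Z$-bridge between diagonally connected blocks $B_1,B_2$ is a pair $T=(P,c)$ where $P=(P(0),\dots,P(k))$ is a $Z$-path with $(P(0),P(k))=(B_1^+,B_2^+)$ (positive bridge) or $(B_1^-,B_2^-)$ (negative bridge), and $c(x)=3$ for $x\in P$, $c(x)=0$ otherwise; it is a source $Z$-bridge if instead $c(P(0))=4$ (other values unchanged). -}

module Defs where

open import Data.Nat as ℕ using (ℕ; zero; suc; _∸_; _≤ᵇ_)
open import Data.Integer as ℤ using (ℤ; +_; -_; 1ℤ; -1ℤ)
open import Data.Product using (_×_; _,_; ∃; ∃-syntax; Σ-syntax)
open import Data.Sum using (_⊎_)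
open import Data.Bool using (if_then_else_)
open import Data.Fin using (Fin; zero; suc; inject₁)
open import Data.Fin.Properties using (any?)
open import Data.Vec using (Vec; []; _∷_; lookup)
open import Data.Product.Properties using (≡-dec)
open import Relation.Nullary using (Dec; yes; no; ¬_)
open import Relation.Binary.PropositionalEquality using (_≡_)

-- Cells of ℤ², second coordinate increasing downward.
Cell : Set
Cell = ℤ × ℤ

_⊕_ : Cell → Cell → Cell
(a , b) ⊕ (c , d) = (a ℤ.+ c , b ℤ.+ d)

_⊖_ : Cell → Cell → Cell
(a , b) ⊖ (c , d) = (a ℤ.- c , b ℤ.- d)

_≟C_ : (x y : Cell) → Dec (x ≡ y)
_≟C_ = ≡-dec ℤ._≟_ ℤ._≟_

-- Configurations c : ℤ² → {0,…,5}, represented with values in ℕ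
-- (the update rule keeps values in {0,…,5}).
Config : Set
Config = Cell → ℕ

data Dir : Set where
  H V : Dir

vec : Dir → Cell
vec H = (1ℤ , + 0)
vec V = (+ 0 , 1ℤ)

[≥4] : ℕ → ℕ
[≥4] n = if 4 ≤ᵇ n then 1 else 0

step : Config → Dir → Config
step c d x = (c x ∸ 2 ℕ.* [≥4] (c x)) ℕ.+ [≥4] (c (x ⊕ vec d)) ℕ.+ [≥4] (c (x ⊖ vec d))

applyZ : ∀ {k} → Config → Vec Dir k → Config
applyZ c []      = c
applyZ c (d ∷ Z) = applyZ (step c d) Z

countH : ∀ {k} → Vec Dir k → ℕ
countH []      = 0
countH (H ∷ Z) = suc (countH Z)
countH (V ∷ Z) = countH Z

countV : ∀ {k} → Vec Dir k → ℕ
countV []      = 0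
countV (H ∷ Z) = countV Z
countV (V ∷ Z) = suc (countV Z)

-- Z-blocks of the partition with offset a: block with index (i,j) is
-- a + (i h, j v) + {0..h-1}×{0..v-1}; its upper-left cell B⁺:
blockPlus : ∀ {k} → Vec Dir k → Cell → ℤ × ℤ → Cell
blockPlus Z a (i , j) = a ⊕ (i ℤ.* + countH Z , j ℤ.* + countV Z)

Sign : ℤ → Set
Sign σ = σ ≡ 1ℤ ⊎ σ ≡ -1ℤ

DiagConnected : ∀ {k} → Vec Dir k → Cell → ℤ × ℤ → ℤ × ℤ → Set
DiagConnected Z a B₁ B₂ =
  ∃[ σ ] ∃[ τ ] (Sign σ × Sign τ ×
    (blockPlus Z a B₂ ≡ blockPlus Z a B₁ ⊕ (σ ℤ.* + countH Z , τ ℤ.* + countV Z)))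

signedVec : ℤ → ℤ → Dir → Cell
signedVec α β H = (α , + 0)
signedVec α β V = (+ 0 , β)

IsZPath : ∀ {k} → Vec Dir k → (Fin (suc k) → Cell) → Set
IsZPath {k} Z P = ∃[ α ] ∃[ β ] (Sign α × Sign β ×
  ((s : Fin k) → P (suc s) ≡ P (inject₁ s) ⊕ signedVec α β (lookup Z s)))

_∈P_ : ∀ {k} → Cell → (Fin (suc k) → Cell) → Set
x ∈P P = ∃[ s ] P s ≡ x

_∈P?_ : ∀ {k} (x : Cell) (P : Fin (suc k) → Cell) → Dec (x ∈P P)
x ∈P? P = any? (λ s → P s ≟C x)

sourceBridgeConfig : ∀ {k} → (Fin (suc k) → Cell) → Config
sourceBridgeConfig P x with x ≟C P zero
... | yes _ = 4
... | no _ with x ∈P? P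
...   | yes _ = 3
...   | no _ = 0

IsPositiveSourceBridge : ∀ {k} → Vec Dir k → Cell → ℤ × ℤ → ℤ × ℤ →
  (Fin (suc k) → Cell) → Config → Set
IsPositiveSourceBridge {k} Z a B₁ B₂ P c =
  IsZPath Z P × P zero ≡ blockPlus Z a B₁ × P (Data.Fin.fromℕ k) ≡ blockPlus Z a B₂
  × ((x : Cell) → c x ≡ sourceBridgeConfig P x)

{-# OPTIONS --safe #-}
-- The 4 at P(0) is handed along the path, one cell per update. Call a cell
-- ahead of p if it lies strictly beyond p in direction α along the first
-- coordinate or in direction β along the second. After s updates the cell
-- P(s) holds 4 and every cell ahead of P(s) still holds its initial value,
-- which is at most 3. The update Z(s+1) changes no cell ahead of P(s+1): such a
-- cell and both of its neighbours along Z(s+1) lie ahead of P(s), so none of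
-- them topples. And P(s+1), which holds 3, receives exactly one grain: one of
-- its neighbours is P(s), the other lies ahead of P(s).
module Submission where

open import Defs
open import Data.Nat using (ℕ; suc; _≤_; z≤n; s≤s)
open import Data.Nat.Properties using (+-identityʳ; ≤-refl; ≤-antisym)
open import Data.Integer using (ℤ; +_; +[1+_]; 0ℤ; 1ℤ; -1ℤ; _+_; _-_; _*_)
open import Data.Integer.Properties as ℤ using (*-identityʳ; +-inverseʳ)
open import Data.Integer.Tactic.RingSolver using (solve-∀)
open import Data.Product using (_×_; _,_)
open import Data.Sum using (_⊎_; inj₁; inj₂)
open import Data.Fin using (Fin; zero; suc; inject₁; fromℕ)
open import Data.Vec using (Vec; []; _∷_; lookup)
open import Function using (_∘_)
open import Relation.Nullary using (¬_; yes; no; contradiction)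
open import Relation.Binary.PropositionalEquality
  using (_≡_; _≢_; refl; sym; trans; cong; cong₂; subst; module ≡-Reasoning)

i+j-j≡i : ∀ i j → i + j - j ≡ i
i+j-j≡i = solve-∀

i≡i+j⇒0≡j : ∀ {i j} → i ≡ i + j → 0ℤ ≡ j
i≡i+j⇒0≡j {i} {j} i≡ = begin
  0ℤ        ≡⟨ sym (+-inverseʳ i) ⟩
  i - i     ≡⟨ cong (_- i) i≡ ⟩
  i + j - i ≡⟨ identity i j ⟩
  j         ∎
  where
  open ≡-Reasoning
  identity : ∀ i j → i + j - i ≡ j
  identity = solve-∀

record Beyond (α x y : ℤ) : Set where
  constructor _,_
  field
    steps    : ℕ
    position : y ≡ x + α * +[1+ steps ]

module _ {α x : ℤ} where

  beyond-step : Beyond α x (x + α)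
  beyond-step = 0 , cong (_+_ x) (sym (*-identityʳ α))

  beyond-extend : ∀ {y} → Beyond α x y → Beyond α x (y + α)
  beyond-extend (n , y≡) = suc n , trans (cong (_+ α) y≡) (identity x α (+ n))
    where
    identity : ∀ x α m → x + α * (1ℤ + m) + α ≡ x + α * (1ℤ + (1ℤ + m))
    identity = solve-∀

  beyond-retreat : ∀ {y} → Beyond α (x + α) y → Beyond α x y
  beyond-retreat (n , y≡) = suc n , trans y≡ (identity x α (+ n))
    where
    identity : ∀ x α m → x + α + α * (1ℤ + m) ≡ x + α * (1ℤ + (1ℤ + m))
    identity = solve-∀

  beyond-back : ∀ {y} → Beyond α (x + α) y → Beyond α x (y - α)
  beyond-back (n , y≡) = n , trans (cong (_- α) y≡) (identity x α (+ n))
    where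
    identity : ∀ x α m → x + α + α * (1ℤ + m) - α ≡ x + α * (1ℤ + m)
    identity = solve-∀

beyond-neighbours : ∀ {α x y} → Sign α → Beyond α (x + α) y →
                    Beyond α x (y + 1ℤ) × Beyond α x (y - 1ℤ)
beyond-neighbours (inj₁ refl) b =
  beyond-extend (beyond-retreat b) , beyond-back b
beyond-neighbours (inj₂ refl) b =
  beyond-back b , beyond-extend (beyond-retreat b)

beyond-step-neighbours : ∀ {α} → Sign α → ∀ x →
  (x + α - 1ℤ ≡ x × Beyond α x (x + α + 1ℤ)) ⊎ (x + α + 1ℤ ≡ x × Beyond α x (x + α - 1ℤ))
beyond-step-neighbours (inj₁ refl) x = inj₁ (i+j-j≡i x 1ℤ , beyond-extend beyond-step)
beyond-step-neighbours (inj₂ refl) x = inj₂ (i+j-j≡i x -1ℤ , beyond-extend beyond-step)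

beyond-perpendicular : ∀ {β x y} → Beyond β (x + 0ℤ) y → Beyond β x y × Beyond β x (y + 0ℤ)
beyond-perpendicular {x = x} {y} b rewrite ℤ.+-identityʳ x | ℤ.+-identityʳ y = b , b

beyond-irrefl : ∀ {α x} → Sign α → ¬ Beyond α x x
beyond-irrefl (inj₁ refl) (n , x≡) = contradiction (i≡i+j⇒0≡j x≡) λ ()
beyond-irrefl (inj₂ refl) (n , x≡) = contradiction (i≡i+j⇒0≡j x≡) λ ()

Ahead : ℤ → ℤ → Cell → Cell → Set
Ahead α β (p₁ , p₂) (x₁ , x₂) = Beyond α p₁ x₁ ⊎ Beyond β p₂ x₂

module _ {α β : ℤ} (sα : Sign α) (sβ : Sign β) where

  ahead-irrefl : ∀ {p} → ¬ Ahead α β p p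
  ahead-irrefl (inj₁ b) = beyond-irrefl sα b
  ahead-irrefl (inj₂ b) = beyond-irrefl sβ b

  ahead-step : ∀ d p → Ahead α β p (p ⊕ signedVec α β d)
  ahead-step H p = inj₁ beyond-step
  ahead-step V p = inj₂ beyond-step

  ahead-retreat : ∀ d p x → Ahead α β (p ⊕ signedVec α β d) x →
                  Ahead α β p x × Ahead α β p (x ⊕ vec d) × Ahead α β p (x ⊖ vec d)
  ahead-retreat H p x (inj₁ b) with beyond-neighbours sα b
  ... | b₊ , b₋ = inj₁ (beyond-retreat b) , inj₁ b₊ , inj₁ b₋
  ahead-retreat H p x (inj₂ b) with beyond-perpendicular b
  ... | b₀ , b₁ = inj₂ b₀ , inj₂ b₁ , inj₂ b₁
  ahead-retreat V p x (inj₁ b) with beyond-perpendicular b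
  ... | b₀ , b₁ = inj₁ b₀ , inj₁ b₁ , inj₁ b₁
  ahead-retreat V p x (inj₂ b) with beyond-neighbours sβ b
  ... | b₊ , b₋ = inj₂ (beyond-retreat b) , inj₂ b₊ , inj₂ b₋

  next-neighbours : ∀ d p → let q = p ⊕ signedVec α β d in
                    (q ⊖ vec d ≡ p × Ahead α β p (q ⊕ vec d)) ⊎
                    (q ⊕ vec d ≡ p × Ahead α β p (q ⊖ vec d))
  next-neighbours H (p₁ , p₂) with beyond-step-neighbours sα p₁
  ... | inj₁ (q₋≡p , b) = inj₁ (cong₂ _,_ q₋≡p (i+j-j≡i p₂ 0ℤ) , inj₁ b)
  ... | inj₂ (q₊≡p , b) = inj₂ (cong₂ _,_ q₊≡p (i+j-j≡i p₂ 0ℤ) , inj₁ b)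
  next-neighbours V (p₁ , p₂) with beyond-step-neighbours sβ p₂
  ... | inj₁ (q₋≡p , b) = inj₁ (cong₂ _,_ (i+j-j≡i p₁ 0ℤ) q₋≡p , inj₂ b)
  ... | inj₂ (q₊≡p , b) = inj₂ (cong₂ _,_ (i+j-j≡i p₁ 0ℤ) q₊≡p , inj₂ b)

[≥4]-≤3 : ∀ {n} → n ≤ 3 → [≥4] n ≡ 0
[≥4]-≤3 z≤n                   = refl
[≥4]-≤3 (s≤s z≤n)             = refl
[≥4]-≤3 (s≤s (s≤s z≤n))       = refl
[≥4]-≤3 (s≤s (s≤s (s≤s z≤n))) = refl

step-idle : ∀ c d x → c x ≤ 3 → c (x ⊕ vec d) ≤ 3 → c (x ⊖ vec d) ≤ 3 → step c d x ≡ c x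
step-idle c d x cx≤3 c₊≤3 c₋≤3
  rewrite [≥4]-≤3 cx≤3 | [≥4]-≤3 c₊≤3 | [≥4]-≤3 c₋≤3 =
  trans (+-identityʳ _) (+-identityʳ (c x))

step-receives : ∀ c d x → c x ≡ 3 →
                (c (x ⊖ vec d) ≡ 4 × c (x ⊕ vec d) ≤ 3) ⊎
                (c (x ⊕ vec d) ≡ 4 × c (x ⊖ vec d) ≤ 3) →
                step c d x ≡ 4
step-receives c d x cx≡3 (inj₁ (c₋≡4 , c₊≤3)) rewrite cx≡3 | c₋≡4 | [≥4]-≤3 c₊≤3 = refl
step-receives c d x cx≡3 (inj₂ (c₊≡4 , c₋≤3)) rewrite cx≡3 | c₊≡4 | [≥4]-≤3 c₋≤3 = refl

QuietAhead : ℤ → ℤ → Cell → Config → Config → Set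
QuietAhead α β p c c̃ = ∀ x → Ahead α β p x → c x ≡ c̃ x × c̃ x ≤ 3

quiet-≤3 : ∀ {α β p c c̃} → QuietAhead α β p c c̃ → ∀ x → Ahead α β p x → c x ≤ 3
quiet-≤3 quiet x ahead with quiet x ahead
... | cx≡c̃x , c̃x≤3 = subst (_≤ 3) (sym cx≡c̃x) c̃x≤3

module _ {α β : ℤ} (sα : Sign α) (sβ : Sign β) (d : Dir) (p : Cell) (c c̃ : Config) where

  private
    q : Cell
    q = p ⊕ signedVec α β d

  quiet-advances : QuietAhead α β p c c̃ → QuietAhead α β q (step c d) c̃
  quiet-advances quiet x ahead with ahead-retreat sα sβ d p x ahead
  ... | ahead₀ , ahead₊ , ahead₋ with quiet x ahead₀
  ... | cx≡c̃x , c̃x≤3 =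
    trans (step-idle c d x (≤3 x ahead₀) (≤3 _ ahead₊) (≤3 _ ahead₋)) cx≡c̃x , c̃x≤3
    where
    ≤3 : ∀ x → Ahead α β p x → c x ≤ 3
    ≤3 = quiet-≤3 quiet

  grain-advances : 3 ≤ c̃ q → QuietAhead α β p c c̃ → c p ≡ 4 → step c d q ≡ 4
  grain-advances 3≤c̃q quiet cp≡4 = step-receives c d q cq≡3 neighbours
    where
    cq≡3 : c q ≡ 3
    cq≡3 with quiet q (ahead-step sα sβ d p)
    ... | cq≡c̃q , c̃q≤3 = trans cq≡c̃q (≤-antisym c̃q≤3 3≤c̃q)
    neighbours : (c (q ⊖ vec d) ≡ 4 × c (q ⊕ vec d) ≤ 3) ⊎
                 (c (q ⊕ vec d) ≡ 4 × c (q ⊖ vec d) ≤ 3)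
    neighbours with next-neighbours sα sβ d p
    ... | inj₁ (q₋≡p , ahead₊) = inj₁ (trans (cong c q₋≡p) cp≡4 , quiet-≤3 quiet _ ahead₊)
    ... | inj₂ (q₊≡p , ahead₋) = inj₂ (trans (cong c q₊≡p) cp≡4 , quiet-≤3 quiet _ ahead₋)

grain-propagates : ∀ {k α β} → Sign α → Sign β → (Z : Vec Dir k) (Q : Fin (suc k) → Cell) →
  (∀ s → Q (suc s) ≡ Q (inject₁ s) ⊕ signedVec α β (lookup Z s)) →
  (c c̃ : Config) → (∀ j → 3 ≤ c̃ (Q (suc j))) →
  QuietAhead α β (Q zero) c c̃ → c (Q zero) ≡ 4 →
  applyZ c Z (Q (fromℕ k)) ≡ 4
grain-propagates sα sβ [] Q steps c c̃ on-path quiet cQ₀≡4 = cQ₀≡4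
grain-propagates {α = α} {β} sα sβ (d ∷ Z) Q steps c c̃ on-path quiet cQ₀≡4 =
  grain-propagates sα sβ Z (Q ∘ suc) (steps ∘ suc) (step c d) c̃ (on-path ∘ suc) quiet₁ cQ₁≡4
  where
  Q₁≡q : Q (suc zero) ≡ Q zero ⊕ signedVec α β d
  Q₁≡q = steps zero
  quiet₁ : QuietAhead α β (Q (suc zero)) (step c d) c̃
  quiet₁ = subst (λ q → QuietAhead α β q (step c d) c̃) (sym Q₁≡q)
             (quiet-advances sα sβ d (Q zero) c c̃ quiet)
  cQ₁≡4 : step c d (Q (suc zero)) ≡ 4
  cQ₁≡4 = subst (λ q → step c d q ≡ 4) (sym Q₁≡q)
            (grain-advances sα sβ d (Q zero) c c̃ 3≤c̃q quiet cQ₀≡4)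
    where
    3≤c̃q : 3 ≤ c̃ (Q zero ⊕ signedVec α β d)
    3≤c̃q = subst (λ q → 3 ≤ c̃ q) Q₁≡q (on-path zero)

sourceBridgeConfig-source : ∀ {k} (P : Fin (suc k) → Cell) → sourceBridgeConfig P (P zero) ≡ 4
sourceBridgeConfig-source P with P zero ≟C P zero
... | yes _   = refl
... | no P₀≢P₀ = contradiction refl P₀≢P₀

sourceBridgeConfig-≥3 : ∀ {k} (P : Fin (suc k) → Cell) j → 3 ≤ sourceBridgeConfig P (P j)
sourceBridgeConfig-≥3 P j with P j ≟C P zero
... | yes _ = s≤s (s≤s (s≤s z≤n))
... | no _ with P j ∈P? P
...   | yes _  = ≤-refl
...   | no Pj∉P = contradiction (j , refl) Pj∉P

sourceBridgeConfig-≤3 : ∀ {k} (P : Fin (suc k) → Cell) x → x ≢ P zero → sourceBridgeConfig P x ≤ 3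
sourceBridgeConfig-≤3 P x x≢P₀ with x ≟C P zero
... | yes x≡P₀ = contradiction x≡P₀ x≢P₀
... | no _ with x ∈P? P
...   | yes _ = ≤-refl
...   | no _  = z≤n

lemma2 : ∀ {k} (Z : Vec Dir k) (a : Cell) (B₁ B₂ : ℤ × ℤ)
    → DiagConnected Z a B₁ B₂
    → (P : Fin (suc k) → Cell) (c : Config)
    → IsPositiveSourceBridge Z a B₁ B₂ P c
    → (c̃ : Config)
    → ((x : Cell) → x ∈P P → c̃ x ≡ c x)
    → ((x : Cell) → ¬ (x ∈P P) → c̃ x ≤ 3)
    → applyZ c̃ Z (P (fromℕ k)) ≡ 4
lemma2 Z a B₁ B₂ _ P c ((α , β , sα , sβ , steps) , _ , _ , c≡bridge) c̃ c̃≡c c̃≤3 =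
  grain-propagates sα sβ Z P steps c̃ c̃ on-path quiet c̃P₀≡4
  where
  c̃≡bridge : ∀ x → x ∈P P → c̃ x ≡ sourceBridgeConfig P x
  c̃≡bridge x x∈P = trans (c̃≡c x x∈P) (c≡bridge x)
  on-path : ∀ j → 3 ≤ c̃ (P (suc j))
  on-path j = subst (3 ≤_) (sym (c̃≡bridge _ (suc j , refl))) (sourceBridgeConfig-≥3 P (suc j))
  quiet : QuietAhead α β (P zero) c̃ c̃
  quiet x ahead with x ∈P? P
  ... | no x∉P = refl , c̃≤3 x x∉P
  ... | yes x∈P = refl , subst (_≤ 3) (sym (c̃≡bridge x x∈P))
                     (sourceBridgeConfig-≤3 P x λ { refl → ahead-irrefl sα sβ ahead })
  c̃P₀≡4 : c̃ (P zero) ≡ 4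
  c̃P₀≡4 = trans (c̃≡bridge _ (zero , refl)) (sourceBridgeConfig-source P)
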